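{- Let $n$ be a positive integer and let $A$ be an MSTD set that is $P_n$, with $A=L\cup R$ where $L\subseteq[1,n]$ and $R\subseteq[n+1,2n]$, such that $[1,4]\cup\{n\}\subseteq L$ and $\{n+1\}\cup[2n-3,2n]\subseteq R$. Pick an integer $k\ge n/2+2$ and an integer $m\ge 0$. Form $O_1=\{n+4\}\cup[n+5,n+2k+1]_2\cup\{n+2k+2\}$ and $O_2=\{n+m+2k+3\}\cup[n+m+2k+4,n+m+4k]_2\cup\{n+m+4k+1\}$. Let $M\subseteq[n+2k+3,n+m+2k+2]$ be such that within $M$ there exists a sequence of pairs of consecutive integers $\{x_1,x_1+1\},\dots,\{x_t,x_t+1\}\subseteq M$ with $x_1<\dots<x_t$, where consecutive pairs in the sequence are not more than $2k-1$ apart (i.e. $x_{j+1}-x_j\le 2k-1$), the first pair lies in $[n+2k+3,n+4k+1]$ and the last pair lies in $[n+m+4,n+m+2k+2]$. Let $R'=R+m+4k+4$ and $A'=L\cup O_1\cup M\cup O_2\cup R'$. Then $A'$ is MSTD.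
   Context: For integers $a\le b$, $[a,b]=\{\ell\in\mathbb{Z}:a\le\ell\le b\}$ and $[a,b]_2=\{\ell\in\mathbb{Z}:a\le\ell\le b,\ \ell-a\text{ even}\}$. For a set $A$ of integers, $A+A=\{x+y:x,y\in A\}$, $A-A=\{x-y:x,y\in A\}$, $A+t=\{x+t:x\in A\}$. A finite set $A$ is MSTD if $|A+A|>|A-A|$. A finite set $A$ with $a=\min A$, $b=\max A$ is $P_n$ if $A+A\supseteq[2a+n,2b-n]$ and $A-A\supseteq[(a-b)+n,(b-a)-n]$. -}

module Defs where

open import Data.Nat as ℕ using (ℕ; zero; suc)
open import Data.Nat.DivMod using (_/_)
open import Data.Integer using (ℤ; +_; _+_; _-_; _*_; _≤_; _<_; _≤?_; ∣_∣)
open import Data.Integer.Properties using () renaming (_≟_ to _≟ℤ_)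
open import Data.List using (List; []; map; concatMap; length; upTo; deduplicate; _++_)
open import Data.List.Membership.Propositional using (_∈_)
open import Data.List.Relation.Unary.All using (All)
open import Data.Product using (_×_)
open import Data.Bool using (if_then_else_)
open import Relation.Nullary.Decidable using (⌊_⌋)

-- Finite sets of integers are represented by lists (duplicates allowed);
-- the cardinality of a set is the length of the deduplicated list.
card : List ℤ → ℕ
card A = length (deduplicate _≟ℤ_ A)

sumset : List ℤ → List ℤ
sumset A = concatMap (λ x → map (λ y → x + y) A) A

diffset : List ℤ → List ℤ
diffset A = concatMap (λ x → map (λ y → x - y) A) A

MSTD : List ℤ → Set
MSTD A = card (diffset A) ℕ.< card (sumset A)

interval : ℤ → ℤ → List ℤ
interval a b = if ⌊ a ≤? b ⌋ then map (λ i → a + + i) (upTo (suc ∣ b - a ∣)) else []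

interval₂ : ℤ → ℤ → List ℤ
interval₂ a b = if ⌊ a ≤? b ⌋ then map (λ i → a + + (2 ℕ.* i)) (upTo (suc (∣ b - a ∣ / 2))) else []

shift : List ℤ → ℤ → List ℤ
shift A t = map (λ x → x + t) A

IsMin : ℤ → List ℤ → Set
IsMin a A = (a ∈ A) × All (λ x → a ≤ x) A

IsMax : ℤ → List ℤ → Set
IsMax b A = (b ∈ A) × All (λ x → x ≤ b) A

P : ℤ → List ℤ → Set
P n A = ∀ a b → IsMin a A → IsMax b A →
  (∀ x → + 2 * a + n ≤ x → x ≤ + 2 * b - n → x ∈ sumset A) ×
  (∀ x → (a - b) + n ≤ x → x ≤ (b - a) - n → x ∈ diffset A)

O₁ : ℤ → ℤ → List ℤ
O₁ n k = (n + + 4) Data.List.∷ interval₂ (n + + 5) (n + + 2 * k + + 1) ++ ((n + + 2 * k + + 2) Data.List.∷ [])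

O₂ : ℤ → ℤ → ℤ → List ℤ
O₂ n k m = (n + m + + 2 * k + + 3) Data.List.∷ interval₂ (n + m + + 2 * k + + 4) (n + m + + 4 * k)
           ++ ((n + m + + 4 * k + + 1) Data.List.∷ [])

module Submission where

-- Write c = m + 4k + 4 and N = 2n + c, so that A ⊆ [1, 2n]
-- and A' ⊆ [1, N], and split each of A - A, A + A, A' - A', A' + A' into a
-- left window of length n, a middle window and a right window of length n.
--   * Only L and R contribute to the outer windows (Layout, diff-low, ...):
--     the outer windows of A' - A' embed into those of A - A (a difference
--     u - (r + c) with u ∈ L, r ∈ R becomes u - r), and the outer windows of
--     A + A embed into those of A' + A' (shifting sums of R by 2c).
--   * The middle window of A - A is full because A is P_n, and the middle
--     window [n + 2, 2N - n] of A' + A' is full: the combs O₁, O₂ added to a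
--     chain of consecutive pairs with gaps at most 2k - 1 running from 1 ∈ L
--     through O₁, the pairs of M and O₂ up to the top of R + c cover it
--     (comb+chain, middle-covered).
-- Counting window by window (card≤windows, windows≤card) then gives
-- |A' - A'| - |A - A| ≤ ℓ' - ℓ ≤ |A' + A'| - |A + A|, where ℓ, ℓ' are the
-- lengths of the middle windows, so A' inherits |A' - A'| < |A' + A'|.

open import Defs
open import Data.Nat using (ℕ; suc)
open import Data.Fin using (Fin; zero; inject₁; fromℕ) renaming (suc to fsuc)
open import Data.Integer using (ℤ; +_; _+_; _-_; _*_; _≤_; _<_)
open import Data.List using (List; _++_; _∷_; [])
open import Data.List.Membership.Propositional using (_∈_)
open import Data.List.Relation.Unary.All using (All)
open import Data.Product using (_×_)

open import Data.Nat as ℕ using (zero; z≤n; s≤s)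
import Data.Nat.Properties as ℕP
open import Data.Nat.DivMod using (_/_; m/n*n≤m; m*n/n≡m)
open import Data.Integer as ℤ using (+≤+; ∣_∣)
import Data.Integer.Properties as ℤP
open import Data.Integer.Tactic.RingSolver using (solve-∀)
open import Data.List using (map; upTo; length; deduplicate)
open import Data.List.Membership.Propositional using (_∉_)
open import Data.List.Membership.Propositional.Properties
  using (∈-map⁺; ∈-map⁻; ∈-++⁺ˡ; ∈-++⁺ʳ; ∈-++⁻; ∈-concat⁺′; ∈-concat⁻′; ∈-upTo⁺; ∈-upTo⁻;
         ∈-deduplicate⁺; ∈-deduplicate⁻)
open import Data.List.Membership.DecPropositional ℤP._≟_ using (_∈?_)
open import Data.List.Relation.Unary.All as All using ([]; _∷_)
open import Data.List.Relation.Unary.Any using (here; there)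
open import Data.List.Relation.Unary.Unique.Propositional using (Unique)
open import Data.List.Relation.Unary.Unique.DecPropositional.Properties ℤP._≟_ using (deduplicate-!)
open import Data.List.Relation.Unary.AllPairs using ([]; _∷_)
open import Data.Product using (_,_; proj₁; proj₂; ∃; ∃₂)
open import Data.Sum using (inj₁; inj₂)
open import Data.Bool using (if_then_else_)
open import Data.Empty using (⊥; ⊥-elim)
open import Relation.Nullary using (Dec; yes; no; ¬_; contradiction)
open import Relation.Nullary.Decidable using (⌊_⌋)
open import Relation.Binary.PropositionalEquality

-- Inequalities between integer expressions are proved by certificate: to
-- show a ≤ b one exhibits b - a as a sum of manifestly non-negative terms,
-- the identity between the two being checked by the ring solver.
NonNeg : ℤ → Set
NonNeg d = + 0 ≤ d

≤-by : ∀ {a b} d → NonNeg d → b - a ≡ d → a ≤ b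
≤-by d d≥0 eq = ℤP.0≤i-j⇒j≤i (subst NonNeg (sym eq) d≥0)

<-by : ∀ {a b} d → NonNeg d → b - (+ 1 + a) ≡ d → a < b
<-by d d≥0 eq = ℤP.suc[i]≤j⇒i<j (≤-by d d≥0 eq)

gap : ∀ {a b} → a ≤ b → NonNeg (b - a)
gap = ℤP.i≤j⇒0≤j-i

gap< : ∀ {a b} → a < b → NonNeg (b - (+ 1 + a))
gap< a<b = gap (ℤP.i<j⇒suc[i]≤j a<b)

nat : ∀ n → NonNeg (+ n)
nat n = +≤+ z≤n

infixl 6 _⊕_
_⊕_ : ∀ {a b} → NonNeg a → NonNeg b → NonNeg (a + b)
_⊕_ = ℤP.+-mono-≤

scale : ∀ j {d} → NonNeg d → NonNeg (+ j * d)
scale j (+≤+ {n = d} _) = subst NonNeg (ℤP.pos-* j d) (nat (j ℕ.* d))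

impossible-by : ∀ {x} → NonNeg x → x + + 1 ≡ + 0 → ⊥
impossible-by {x} x≥0 eq with subst (+ 1 ≤_) eq (ℤP.+-monoˡ-≤ (+ 1) x≥0)
... | +≤+ ()

∈sumset⁺ : ∀ {A u v x} → u ∈ A → v ∈ A → x ≡ u + v → x ∈ sumset A
∈sumset⁺ {A} {u} u∈ v∈ refl =
  ∈-concat⁺′ (∈-map⁺ (λ y → u + y) v∈) (∈-map⁺ (λ x → map (λ y → x + y) A) u∈)

∈diffset⁺ : ∀ {A u v x} → u ∈ A → v ∈ A → x ≡ u - v → x ∈ diffset A
∈diffset⁺ {A} {u} u∈ v∈ refl =
  ∈-concat⁺′ (∈-map⁺ (λ y → u - y) v∈) (∈-map⁺ (λ x → map (λ y → x - y) A) u∈)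

∈sumset⁻ : ∀ {A x} → x ∈ sumset A → ∃₂ λ u v → (u ∈ A) × (v ∈ A) × (x ≡ u + v)
∈sumset⁻ {A} p with ∈-concat⁻′ (map (λ x → map (λ y → x + y) A) A) p
... | ys , x∈ys , ys∈ with ∈-map⁻ (λ x → map (λ y → x + y) A) ys∈
... | u , u∈ , refl with ∈-map⁻ (λ y → u + y) x∈ys
... | v , v∈ , refl = u , v , u∈ , v∈ , refl

∈diffset⁻ : ∀ {A x} → x ∈ diffset A → ∃₂ λ u v → (u ∈ A) × (v ∈ A) × (x ≡ u - v)
∈diffset⁻ {A} p with ∈-concat⁻′ (map (λ x → map (λ y → x - y) A) A) p
... | ys , x∈ys , ys∈ with ∈-map⁻ (λ x → map (λ y → x - y) A) ys∈
... | u , u∈ , refl with ∈-map⁻ (λ y → u - y) x∈ys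
... | v , v∈ , refl = u , v , u∈ , v∈ , refl

sumset-mono : ∀ {X Y s} → (∀ {z} → z ∈ X → z ∈ Y) → s ∈ sumset X → s ∈ sumset Y
sumset-mono {X} {Y} X⊆Y s∈ with ∈sumset⁻ {X} s∈
... | u , v , u∈ , v∈ , refl = ∈sumset⁺ {Y} (X⊆Y u∈) (X⊆Y v∈) refl

diffset-neg : ∀ {A x} → x ∈ diffset A → ℤ.- x ∈ diffset A
diffset-neg {A} p with ∈diffset⁻ {A} p
... | u , v , u∈ , v∈ , refl = ∈diffset⁺ {A} v∈ u∈ (neg-diff u v)
  where
  neg-diff : ∀ u v → ℤ.- (u - v) ≡ v - u
  neg-diff = solve-∀

windowSum : (ℤ → ℕ) → ℤ → ℕ → ℕ
windowSum f a zero    = 0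
windowSum f a (suc l) = f a ℕ.+ windowSum f (a + + 1) l

private
  next-base : ∀ a i → (a + + 1) + + i ≡ a + + suc i
  next-base a i = ℤP.+-assoc a (+ 1) (+ i)

  i<i+1 : ∀ a → a < a + + 1
  i<i+1 a = subst (a <_) (ℤP.+-comm (+ 1) a) (ℤP.suc[i]≤j⇒i<j ℤP.≤-refl)

windowSum-mono : ∀ f g a b l → (∀ i → i ℕ.< l → f (a + + i) ℕ.≤ g (b + + i)) →
                 windowSum f a l ℕ.≤ windowSum g b l
windowSum-mono f g a b zero    le = z≤n
windowSum-mono f g a b (suc l) le = ℕP.+-mono-≤ first (windowSum-mono f g (a + + 1) (b + + 1) l rest)
  where
  first : f a ℕ.≤ g b
  first = subst₂ (λ u v → f u ℕ.≤ g v) (ℤP.+-identityʳ a) (ℤP.+-identityʳ b) (le 0 (s≤s z≤n))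
  rest : ∀ i → i ℕ.< l → f ((a + + 1) + + i) ℕ.≤ g ((b + + 1) + + i)
  rest i i<l = subst₂ (λ u v → f u ℕ.≤ g v) (sym (next-base a i)) (sym (next-base b i)) (le (suc i) (s≤s i<l))

windowSum-cong : ∀ f g a l → (∀ i → i ℕ.< l → f (a + + i) ≡ g (a + + i)) →
                 windowSum f a l ≡ windowSum g a l
windowSum-cong f g a l eq = ℕP.≤-antisym
  (windowSum-mono f g a a l (λ i i<l → ℕP.≤-reflexive (eq i i<l)))
  (windowSum-mono g f a a l (λ i i<l → ℕP.≤-reflexive (sym (eq i i<l))))

windowSum-+ : ∀ f g a l → windowSum (λ z → f z ℕ.+ g z) a l ≡ windowSum f a l ℕ.+ windowSum g a l
windowSum-+ f g a zero    = refl
windowSum-+ f g a (suc l) = begin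
  (f a ℕ.+ g a) ℕ.+ windowSum (λ z → f z ℕ.+ g z) (a + + 1) l
    ≡⟨ cong ((f a ℕ.+ g a) ℕ.+_) (windowSum-+ f g (a + + 1) l) ⟩
  (f a ℕ.+ g a) ℕ.+ (windowSum f (a + + 1) l ℕ.+ windowSum g (a + + 1) l)
    ≡⟨ ℕP.+-assoc (f a) (g a) _ ⟩
  f a ℕ.+ (g a ℕ.+ (windowSum f (a + + 1) l ℕ.+ windowSum g (a + + 1) l))
    ≡⟨ cong (f a ℕ.+_) (ℕP.+-comm (g a) _) ⟩
  f a ℕ.+ ((windowSum f (a + + 1) l ℕ.+ windowSum g (a + + 1) l) ℕ.+ g a)
    ≡⟨ cong (f a ℕ.+_) (ℕP.+-assoc (windowSum f (a + + 1) l) _ _) ⟩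
  f a ℕ.+ (windowSum f (a + + 1) l ℕ.+ (windowSum g (a + + 1) l ℕ.+ g a))
    ≡⟨ sym (ℕP.+-assoc (f a) _ _) ⟩
  (f a ℕ.+ windowSum f (a + + 1) l) ℕ.+ (windowSum g (a + + 1) l ℕ.+ g a)
    ≡⟨ cong ((f a ℕ.+ windowSum f (a + + 1) l) ℕ.+_) (ℕP.+-comm _ (g a)) ⟩
  (f a ℕ.+ windowSum f (a + + 1) l) ℕ.+ (g a ℕ.+ windowSum g (a + + 1) l) ∎
  where open ≡-Reasoning

windowSum-split : ∀ f a l₁ l₂ → windowSum f a (l₁ ℕ.+ l₂) ≡ windowSum f a l₁ ℕ.+ windowSum f (a + + l₁) l₂
windowSum-split f a zero     l₂ = cong (λ b → windowSum f b l₂) (sym (ℤP.+-identityʳ a))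
windowSum-split f a (suc l₁) l₂ = begin
  f a ℕ.+ windowSum f (a + + 1) (l₁ ℕ.+ l₂)
    ≡⟨ cong (f a ℕ.+_) (windowSum-split f (a + + 1) l₁ l₂) ⟩
  f a ℕ.+ (windowSum f (a + + 1) l₁ ℕ.+ windowSum f ((a + + 1) + + l₁) l₂)
    ≡⟨ cong (λ b → f a ℕ.+ (windowSum f (a + + 1) l₁ ℕ.+ windowSum f b l₂)) (next-base a l₁) ⟩
  f a ℕ.+ (windowSum f (a + + 1) l₁ ℕ.+ windowSum f (a + + suc l₁) l₂)
    ≡⟨ sym (ℕP.+-assoc (f a) _ _) ⟩
  (f a ℕ.+ windowSum f (a + + 1) l₁) ℕ.+ windowSum f (a + + suc l₁) l₂ ∎
  where open ≡-Reasoning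

windowSum-zero : ∀ a l → windowSum (λ _ → 0) a l ≡ 0
windowSum-zero a zero    = refl
windowSum-zero a (suc l) = windowSum-zero (a + + 1) l

windowSum-one : ∀ a l → windowSum (λ _ → 1) a l ≡ l
windowSum-one a zero    = refl
windowSum-one a (suc l) = cong suc (windowSum-one (a + + 1) l)

bit : ∀ {P : Set} → Dec P → ℕ
bit (yes _) = 1
bit (no _)  = 0

indicator : List ℤ → ℤ → ℕ
indicator X z = bit (z ∈? X)

indicator-mono : ∀ {X Y z w} → (z ∈ X → w ∈ Y) → indicator X z ℕ.≤ indicator Y w
indicator-mono {X} {Y} {z} {w} f with z ∈? X | w ∈? Y
... | yes z∈ | yes _  = ℕP.≤-refl
... | yes z∈ | no w∉  = contradiction (f z∈) w∉
... | no _   | _      = z≤n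

indicator-∈ : ∀ {X z} → z ∈ X → indicator X z ≡ 1
indicator-∈ {X} {z} z∈ with z ∈? X
... | yes _ = refl
... | no z∉ = contradiction z∈ z∉

indicator-∉ : ∀ {X z} → z ∉ X → indicator X z ≡ 0
indicator-∉ {X} {z} z∉ with z ∈? X
... | yes z∈ = contradiction z∈ z∉
... | no _   = refl

indicator≤1 : ∀ X z → indicator X z ℕ.≤ 1
indicator≤1 X z with z ∈? X
... | yes _ = ℕP.≤-refl
... | no _  = z≤n

point : ℤ → ℤ → ℕ
point u z = bit (z ℤP.≟ u)

indicator-cons : ∀ {u U} → u ∉ U → ∀ z → indicator (u ∷ U) z ≡ indicator U z ℕ.+ point u z
indicator-cons {u} {U} u∉ z = by-cases (z ℤP.≟ u)
  where
  drop-head : ¬ z ≡ u → z ∈ u ∷ U → z ∈ U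
  drop-head z≢u (here z≡u) = contradiction z≡u z≢u
  drop-head z≢u (there z∈) = z∈
  by-cases : (d : Dec (z ≡ u)) → indicator (u ∷ U) z ≡ indicator U z ℕ.+ bit d
  by-cases (yes refl) = trans (indicator-∈ (here refl)) (cong (ℕ._+ 1) (sym (indicator-∉ u∉)))
  by-cases (no z≢u)   = trans (ℕP.≤-antisym (indicator-mono (drop-head z≢u)) (indicator-mono there))
                              (sym (ℕP.+-identityʳ _))

point-before : ∀ u a l → u < a → windowSum (point u) a l ≡ 0
point-before u a l u<a = trans (windowSum-cong (point u) (λ _ → 0) a l absent) (windowSum-zero a l)
  where
  absent : ∀ i → i ℕ.< l → point u (a + + i) ≡ 0
  absent i _ with (a + + i) ℤP.≟ u
  ... | no _  = refl
  ... | yes e = contradiction (ℤP.<-≤-trans u<a (subst (a ≤_) e (ℤP.i≤i+j a (+ i)))) (ℤP.<-irrefl refl)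

point≤1 : ∀ u a l → windowSum (point u) a l ℕ.≤ 1
point≤1 u a zero    = z≤n
point≤1 u a (suc l) with a ℤP.≟ u
... | yes refl = ℕP.≤-reflexive (cong suc (point-before u (u + + 1) l (i<i+1 u)))
... | no _     = point≤1 u (a + + 1) l

point-in : ∀ u a l → a ≤ u → u < a + + l → 1 ℕ.≤ windowSum (point u) a l
point-in u a zero    a≤u u<a = contradiction (ℤP.≤-<-trans a≤u (subst (u <_) (ℤP.+-identityʳ a) u<a)) (ℤP.<-irrefl refl)
point-in u a (suc l) a≤u u<a with a ℤP.≟ u
... | yes refl = s≤s z≤n
... | no a≢u   = point-in u (a + + 1) l a+1≤u (subst (u <_) (sym (next-base a l)) u<a)
  where
  a+1≤u : a + + 1 ≤ u
  a+1≤u = subst (_≤ u) (ℤP.+-comm (+ 1) a) (ℤP.i<j⇒suc[i]≤j (ℤP.≤∧≢⇒< a≤u a≢u))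

count : List ℤ → ℤ → ℕ → ℕ
count X = windowSum (indicator X)

count-mono : ∀ X Y a b l → (∀ i → i ℕ.< l → a + + i ∈ X → b + + i ∈ Y) → count X a l ℕ.≤ count Y b l
count-mono X Y a b l f = windowSum-mono (indicator X) (indicator Y) a b l (λ i i<l → indicator-mono (f i i<l))

count≤length : ∀ X a l → count X a l ℕ.≤ l
count≤length X a l = subst (count X a l ℕ.≤_) (windowSum-one a l)
  (windowSum-mono (indicator X) (λ _ → 1) a a l (λ i _ → indicator≤1 X _))

count-full : ∀ X a l → (∀ i → i ℕ.< l → a + + i ∈ X) → l ℕ.≤ count X a l
count-full X a l full = subst (ℕ._≤ count X a l) (windowSum-one a l)
  (windowSum-mono (λ _ → 1) (indicator X) a a l (λ i i<l → ℕP.≤-reflexive (sym (indicator-∈ (full i i<l)))))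

count-cons : ∀ {u U} a l → u ∉ U → count (u ∷ U) a l ≡ count U a l ℕ.+ windowSum (point u) a l
count-cons {u} {U} a l u∉ =
  trans (windowSum-cong (indicator (u ∷ U)) (λ z → indicator U z ℕ.+ point u z) a l (λ i _ → indicator-cons u∉ _))
        (windowSum-+ (indicator U) (point u) a l)

private
  head∉tail : ∀ {u : ℤ} {U} → All (λ y → ¬ u ≡ y) U → u ∉ U
  head∉tail (u≢y ∷ _)   (here u≡y) = u≢y u≡y
  head∉tail (_   ∷ u≢s) (there u∈) = head∉tail u≢s u∈

count≤unique : ∀ U a l → Unique U → count U a l ℕ.≤ length U
count≤unique []      a l []          = ℕP.≤-reflexive (trans (windowSum-cong (indicator []) (λ _ → 0) a l (λ i _ → indicator-∉ {[]} {a + + i} λ ()))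
                                                        (windowSum-zero a l))
count≤unique (u ∷ U) a l (u∉ ∷ uniq) = begin
  count (u ∷ U) a l                          ≡⟨ count-cons a l (head∉tail u∉) ⟩
  count U a l ℕ.+ windowSum (point u) a l    ≤⟨ ℕP.+-mono-≤ (count≤unique U a l uniq) (point≤1 u a l) ⟩
  length U ℕ.+ 1                             ≡⟨ ℕP.+-comm (length U) 1 ⟩
  suc (length U)                             ∎
  where open ℕP.≤-Reasoning

unique≤count : ∀ U a l → Unique U → All (λ x → (a ≤ x) × (x < a + + l)) U → length U ℕ.≤ count U a l
unique≤count []      a l []          []                   = z≤n
unique≤count (u ∷ U) a l (u∉ ∷ uniq) ((a≤u , u<) ∷ inside) = begin
  suc (length U)                             ≡⟨ ℕP.+-comm 1 (length U) ⟩
  length U ℕ.+ 1                             ≤⟨ ℕP.+-mono-≤ (unique≤count U a l uniq inside) (point-in u a l a≤u u<) ⟩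
  count U a l ℕ.+ windowSum (point u) a l    ≡⟨ sym (count-cons a l (head∉tail u∉)) ⟩
  count (u ∷ U) a l                          ∎
  where open ℕP.≤-Reasoning

count-dedup : ∀ X a l → count X a l ≡ count (deduplicate ℤP._≟_ X) a l
count-dedup X a l = ℕP.≤-antisym
  (count-mono X (deduplicate ℤP._≟_ X) a a l (λ i _ → ∈-deduplicate⁺ ℤP._≟_))
  (count-mono (deduplicate ℤP._≟_ X) X a a l (λ i _ → ∈-deduplicate⁻ ℤP._≟_ X))

count≤card : ∀ X a l → count X a l ℕ.≤ card X
count≤card X a l = subst (ℕ._≤ card X) (sym (count-dedup X a l))
  (count≤unique (deduplicate ℤP._≟_ X) a l (deduplicate-! X))

card≤count : ∀ X a l → (∀ x → x ∈ X → (a ≤ x) × (x < a + + l)) → card X ℕ.≤ count X a l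
card≤count X a l inside = subst (card X ℕ.≤_) (sym (count-dedup X a l))
  (unique≤count (deduplicate ℤP._≟_ X) a l (deduplicate-! X)
    (All.tabulate (λ {x} x∈ → inside x (∈-deduplicate⁻ ℤP._≟_ X x∈))))

count-split₃ : ∀ X a p ℓ q →
  count X a (p ℕ.+ ℓ ℕ.+ q) ≡ count X a p ℕ.+ count X (a + + p) ℓ ℕ.+ count X (a + + (p ℕ.+ ℓ)) q
count-split₃ X a p ℓ q =
  trans (windowSum-split (indicator X) a (p ℕ.+ ℓ) q)
        (cong (ℕ._+ count X (a + + (p ℕ.+ ℓ)) q) (windowSum-split (indicator X) a p ℓ))

card≤windows : ∀ X a p ℓ q → (∀ x → x ∈ X → (a ≤ x) × (x < a + + (p ℕ.+ ℓ ℕ.+ q))) →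
  card X ℕ.≤ count X a p ℕ.+ ℓ ℕ.+ count X (a + + (p ℕ.+ ℓ)) q
card≤windows X a p ℓ q inside = begin
  card X                                                                      ≤⟨ card≤count X a (p ℕ.+ ℓ ℕ.+ q) inside ⟩
  count X a (p ℕ.+ ℓ ℕ.+ q)                                                   ≡⟨ count-split₃ X a p ℓ q ⟩
  count X a p ℕ.+ count X (a + + p) ℓ ℕ.+ count X (a + + (p ℕ.+ ℓ)) q
    ≤⟨ ℕP.+-monoˡ-≤ (count X (a + + (p ℕ.+ ℓ)) q) (ℕP.+-monoʳ-≤ (count X a p) (count≤length X (a + + p) ℓ)) ⟩
  count X a p ℕ.+ ℓ ℕ.+ count X (a + + (p ℕ.+ ℓ)) q                          ∎
  where open ℕP.≤-Reasoning

windows≤card : ∀ X a p ℓ q → (∀ i → i ℕ.< ℓ → (a + + p) + + i ∈ X) →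
  count X a p ℕ.+ ℓ ℕ.+ count X (a + + (p ℕ.+ ℓ)) q ℕ.≤ card X
windows≤card X a p ℓ q full = begin
  count X a p ℕ.+ ℓ ℕ.+ count X (a + + (p ℕ.+ ℓ)) q
    ≤⟨ ℕP.+-monoˡ-≤ (count X (a + + (p ℕ.+ ℓ)) q) (ℕP.+-monoʳ-≤ (count X a p) (count-full X (a + + p) ℓ full)) ⟩
  count X a p ℕ.+ count X (a + + p) ℓ ℕ.+ count X (a + + (p ℕ.+ ℓ)) q        ≡⟨ sym (count-split₃ X a p ℓ q) ⟩
  count X a (p ℕ.+ ℓ ℕ.+ q)                                                   ≤⟨ count≤card X a (p ℕ.+ ℓ ℕ.+ q) ⟩
  card X                                                                      ∎
  where open ℕP.≤-Reasoning

record Covers (T : List ℤ) (lo hi : ℤ) : Set where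
  constructor covering
  field cover : ∀ x → lo ≤ x → x ≤ hi → x ∈ sumset T
open Covers public

covers-extend : ∀ {T lo hi} → Covers T lo hi → hi + + 1 ∈ sumset T → Covers T lo (hi + + 1)
covers-extend {T} {lo} {hi} cov top = covering λ x lo≤x x≤ → by-cases x lo≤x x≤ (x ℤP.≤? hi)
  where
  by-cases : ∀ x → lo ≤ x → x ≤ hi + + 1 → Dec (x ≤ hi) → x ∈ sumset T
  by-cases x lo≤x x≤  (yes x≤hi) = cover cov x lo≤x x≤hi
  by-cases x lo≤x x≤  (no  x≰hi) = subst (_∈ sumset T) (ℤP.≤-antisym hi+1≤x x≤) top
    where
    hi+1≤x : hi + + 1 ≤ x
    hi+1≤x = subst (_≤ x) (ℤP.+-comm (+ 1) hi) (ℤP.i<j⇒suc[i]≤j (ℤP.≰⇒> x≰hi))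

infixl 5 _∪⟨_⟩_
_∪⟨_⟩_ : ∀ {T a b c d} → Covers T a b → c ≤ b + + 1 → Covers T c d → Covers T a d
_∪⟨_⟩_ {T} {a} {b} {c} {d} cov₁ c≤b+1 cov₂ = covering λ x a≤x x≤d → by-cases x a≤x x≤d (x ℤP.≤? b)
  where
  by-cases : ∀ x → a ≤ x → x ≤ d → Dec (x ≤ b) → x ∈ sumset T
  by-cases x a≤x x≤d (yes x≤b) = cover cov₁ x a≤x x≤b
  by-cases x a≤x x≤d (no  x≰b) =
    cover cov₂ x (ℤP.≤-trans c≤b+1 (subst (_≤ x) (ℤP.+-comm (+ 1) b) (ℤP.i<j⇒suc[i]≤j (ℤP.≰⇒> x≰b)))) x≤d

covers-shrink : ∀ {T a b b'} → Covers T a b → b' ≤ b → Covers T a b'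
covers-shrink cov b'≤b = covering λ x a≤x x≤b' → cover cov x a≤x (ℤP.≤-trans x≤b' b'≤b)

covers-run : ∀ {T u a} r → u ∈ T → (∀ i → i ℕ.≤ r → a + + i ∈ T) → Covers T (u + a) (u + a + + r)
covers-run {T} {u} {a} r u∈ run = covering λ x lo≤x x≤hi → summand x lo≤x x≤hi
  where
  shift-back : ∀ u a x → u + (a + (x - (u + a))) ≡ x
  shift-back = solve-∀
  gap-identity : ∀ u a x r → r - (x - (u + a)) ≡ (u + a + r) - x
  gap-identity = solve-∀
  summand : ∀ x → u + a ≤ x → x ≤ u + a + + r → x ∈ sumset T
  summand x lo≤x x≤hi = ∈sumset⁺ {T} u∈ (run i i≤r) (sym x≡)
    where
    i : ℕ
    i = ∣ x - (u + a) ∣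
    +i≡ : + i ≡ x - (u + a)
    +i≡ = ℤP.0≤i⇒+∣i∣≡i (gap lo≤x)
    x≡ : u + (a + + i) ≡ x
    x≡ = trans (cong (λ j → u + (a + j)) +i≡) (shift-back u a x)
    i≤r : i ℕ.≤ r
    i≤r = ℤP.drop‿+≤+ (subst (_≤ + r) (sym +i≡) (≤-by _ (gap x≤hi) (gap-identity u a x (+ r))))

∈interval₂⁺ : ∀ a b i → a ≤ b → i ℕ.≤ ∣ b - a ∣ / 2 → a + + (2 ℕ.* i) ∈ interval₂ a b
∈interval₂⁺ a b i a≤b i≤ = by-cases (a ℤP.≤? b)
  where
  by-cases : (d : Dec (a ≤ b)) →
    a + + (2 ℕ.* i) ∈ (if ⌊ d ⌋ then map (λ i → a + + (2 ℕ.* i)) (upTo (suc (∣ b - a ∣ / 2))) else [])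
  by-cases (yes _)  = ∈-map⁺ (λ i → a + + (2 ℕ.* i)) (∈-upTo⁺ (s≤s i≤))
  by-cases (no a≰b) = contradiction a≤b a≰b

∈interval₂⁻ : ∀ a b z → z ∈ interval₂ a b → (a ≤ z) × (z ≤ b)
∈interval₂⁻ a b z = by-cases (a ℤP.≤? b)
  where
  by-cases : (d : Dec (a ≤ b)) →
    z ∈ (if ⌊ d ⌋ then map (λ i → a + + (2 ℕ.* i)) (upTo (suc (∣ b - a ∣ / 2))) else []) → (a ≤ z) × (z ≤ b)
  by-cases (no _)    ()
  by-cases (yes a≤b) z∈ with ∈-map⁻ (λ i → a + + (2 ℕ.* i)) z∈
  ... | i , i∈ , refl = ℤP.i≤i+j a (+ (2 ℕ.* i)) , ≤-by _ (gap (+≤+ 2i≤)) (trans (top a b (+ (2 ℕ.* i))) (cong (_- + (2 ℕ.* i)) (sym b-a≡)))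
    where
    2i≤ : 2 ℕ.* i ℕ.≤ ∣ b - a ∣
    2i≤ = ℕP.≤-trans (ℕP.*-monoʳ-≤ 2 (ℕP.m<1+n⇒m≤n (∈-upTo⁻ i∈)))
                     (subst (ℕ._≤ ∣ b - a ∣) (ℕP.*-comm (∣ b - a ∣ / 2) 2) (m/n*n≤m ∣ b - a ∣ 2))
    b-a≡ : + ∣ b - a ∣ ≡ b - a
    b-a≡ = ℤP.0≤i⇒+∣i∣≡i (gap a≤b)
    top : ∀ a b j → b - (a + j) ≡ (b - a) - j
    top = solve-∀

Comb : List ℤ → ℤ → ℤ → Set
Comb T p w = (p ∈ T) × (∀ i → + i ≤ w → p + + 1 + + 2 * + i ∈ T) × (p + + 2 * w + + 2 ∈ T)

comb-mono : ∀ {T T' p w} → (∀ {z} → z ∈ T → z ∈ T') → Comb T p w → Comb T' p w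
comb-mono sub (p∈ , teeth , end∈) = sub p∈ , (λ i i≤w → sub (teeth i i≤w)) , sub end∈

comb-list : ∀ {p a b l} w → NonNeg w → a ≡ p + + 1 → b ≡ p + + 1 + + 2 * w → l ≡ p + + 2 * w + + 2 →
            Comb (p ∷ interval₂ a b ++ l ∷ []) p w
comb-list {p} {a} {b} {l} (+ K) _ refl refl refl =
  here refl , tooth , there (∈-++⁺ʳ (interval₂ a b) (here refl))
  where
  span : ∀ p w → (p + + 1 + + 2 * w) - (p + + 1) ≡ + 2 * w
  span = solve-∀
  a≤b : a ≤ b
  a≤b = ≤-by _ (scale 2 (nat K)) (span p (+ K))
  half-span : ∣ b - a ∣ / 2 ≡ K
  half-span = begin
    ∣ b - a ∣ / 2             ≡⟨ cong (λ d → ∣ d ∣ / 2) (trans (span p (+ K)) (sym (ℤP.pos-* 2 K))) ⟩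
    (2 ℕ.* K) / 2             ≡⟨ cong (_/ 2) (ℕP.*-comm 2 K) ⟩
    (K ℕ.* 2) / 2             ≡⟨ m*n/n≡m K 2 ⟩
    K                         ∎
    where open ≡-Reasoning
  tooth : ∀ i → + i ≤ + K → p + + 1 + + 2 * + i ∈ p ∷ interval₂ a b ++ (p + + 2 * + K + + 2) ∷ []
  tooth i i≤K = there (∈-++⁺ˡ (subst (_∈ interval₂ a b) (cong (λ j → a + j) (ℤP.pos-* 2 i))
                  (∈interval₂⁺ a b i a≤b (subst (i ℕ.≤_) (sym half-span) (ℤP.drop‿+≤+ i≤K)))))

comb-first-pair : ∀ {T p w} → NonNeg w → Comb T p w → (p ∈ T) × (p + + 1 ∈ T)
comb-first-pair {T} {p} w≥0 (p∈ , teeth , _) = p∈ , subst (_∈ T) (no-offset p) (teeth 0 w≥0)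
  where
  no-offset : ∀ p → p + + 1 + + 2 * + 0 ≡ p + + 1
  no-offset = solve-∀

comb-last-pair : ∀ {T p w} → NonNeg w → Comb T p w → (p + + 1 + + 2 * w ∈ T) × (p + + 1 + + 2 * w + + 1 ∈ T)
comb-last-pair {T} {p} {+ K} _ (_ , teeth , end∈) = teeth K ℤP.≤-refl , subst (_∈ T) (regroup p (+ K)) end∈
  where
  regroup : ∀ p w → p + + 2 * w + + 2 ≡ p + + 1 + + 2 * w + + 1
  regroup = solve-∀

-- A comb of width w plus a pair {y, y + 1} covers [p + y, p + y + 2w + 3]:
-- the sums alternate between y and y + 1 added to consecutive teeth.
comb+pair : ∀ {T p w y} → NonNeg w → Comb T p w → y ∈ T → y + + 1 ∈ T →
            Covers T (p + y) (p + y + + 2 * w + + 3)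
comb+pair {T} {p} {+ K} {y} _ (p∈ , teeth , end∈) y∈ y+1∈ =
  subst (Covers T (p + y)) (last-end p y (+ K))
    (covers-extend (up-to K ℕP.≤-refl) (∈sumset⁺ {T} end∈ y+1∈ (last-sum p y (+ K))))
  where
  tooth : ∀ i → i ℕ.≤ K → p + + 1 + + 2 * + i ∈ T
  tooth i i≤K = teeth i (+≤+ i≤K)
  pair : ∀ i → i ℕ.≤ 1 → y + + i ∈ T
  pair zero          _             = subst (_∈ T) (sym (ℤP.+-identityʳ y)) y∈
  pair (suc zero)    _             = y+1∈
  pair (suc (suc _)) (s≤s ())
  first-sum : ∀ p y → p + y + + 1 + + 1 ≡ (p + + 1 + + 2 * + 0) + (y + + 1)
  first-sum = solve-∀
  first-end : ∀ p y → p + y + + 1 + + 1 ≡ p + y + + 2 * + 0 + + 2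
  first-end = solve-∀
  odd-sum : ∀ p y j → p + y + + 2 * j + + 2 + + 1 ≡ (p + + 1 + + 2 * (+ 1 + j)) + y
  odd-sum = solve-∀
  even-sum : ∀ p y j → p + y + + 2 * j + + 2 + + 1 + + 1 ≡ (p + + 1 + + 2 * (+ 1 + j)) + (y + + 1)
  even-sum = solve-∀
  next-end : ∀ p y j → p + y + + 2 * j + + 2 + + 1 + + 1 ≡ p + y + + 2 * (+ 1 + j) + + 2
  next-end = solve-∀
  last-sum : ∀ p y w → p + y + + 2 * w + + 2 + + 1 ≡ (p + + 2 * w + + 2) + (y + + 1)
  last-sum = solve-∀
  last-end : ∀ p y w → p + y + + 2 * w + + 2 + + 1 ≡ p + y + + 2 * w + + 3
  last-end = solve-∀
  up-to : ∀ i → i ℕ.≤ K → Covers T (p + y) (p + y + + 2 * + i + + 2)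
  up-to zero    _   = subst (Covers T (p + y)) (first-end p y)
    (covers-extend (covers-run {T} 1 p∈ pair) (∈sumset⁺ {T} (tooth 0 z≤n) y+1∈ (first-sum p y)))
  up-to (suc i) i<K = subst (Covers T (p + y)) (next-end p y (+ i))
    (covers-extend (covers-extend (up-to i (ℕP.<⇒≤ i<K))
      (∈sumset⁺ {T} (tooth (suc i) i<K) y∈ (odd-sum p y (+ i))))
      (∈sumset⁺ {T} (tooth (suc i) i<K) y+1∈ (even-sum p y (+ i))))

data PairChain (T : List ℤ) (g : ℤ) : ℤ → ℤ → Set where
  pair   : ∀ {a} → a ∈ T → a + + 1 ∈ T → PairChain T g a a
  extend : ∀ {a b c} → PairChain T g a b → c ∈ T → c + + 1 ∈ T → c - b ≤ g → PairChain T g a c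

infixr 5 _⟶⟨_⟩_
_⟶⟨_⟩_ : ∀ {T g a b b' c} → PairChain T g a b → b' - b ≤ g → PairChain T g b' c → PairChain T g a c
chain ⟶⟨ step ⟩ pair c∈ c+1∈            = extend chain c∈ c+1∈ step
chain ⟶⟨ step ⟩ extend rest c∈ c+1∈ step' = extend (chain ⟶⟨ step ⟩ rest) c∈ c+1∈ step'

sequence-chain : ∀ {T g} t (xs : Fin (suc t) → ℤ) →
  (∀ j → (xs j ∈ T) × (xs j + + 1 ∈ T)) →
  (∀ (j : Fin t) → xs (fsuc j) - xs (inject₁ j) ≤ g) →
  PairChain T g (xs zero) (xs (fromℕ t))
sequence-chain zero    xs pairs steps = pair (proj₁ (pairs zero)) (proj₂ (pairs zero))
sequence-chain (suc t) xs pairs steps =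
  extend (sequence-chain t (λ j → xs (inject₁ j)) (λ j → pairs (inject₁ j)) (λ j → steps (inject₁ j)))
         (proj₁ (pairs (fromℕ (suc t)))) (proj₂ (pairs (fromℕ (suc t)))) (steps (fromℕ t))

-- A comb of width w together with a chain of pairs whose steps are at most
-- 2w + 3 covers [p + a, p + b + 2w + 3]: consecutive pairs give overlapping
-- intervals.
comb+chain : ∀ {T p w g a b} → NonNeg w → g ≤ + 2 * w + + 3 → Comb T p w → PairChain T g a b →
             Covers T (p + a) (p + b + + 2 * w + + 3)
comb+chain w≥0 g≤ comb (pair a∈ a+1∈) = comb+pair w≥0 comb a∈ a+1∈
comb+chain {p = p} {w} {g} w≥0 g≤ comb (extend {b = b} {c} chain c∈ c+1∈ step) =
  comb+chain w≥0 g≤ comb chain ∪⟨ touches ⟩ comb+pair w≥0 comb c∈ c+1∈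
  where
  slack : ∀ p w g b c → (p + b + + 2 * w + + 3 + + 1) - (p + c) ≡ ((+ 2 * w + + 3) - g) + (g - (c - b)) + + 1
  slack = solve-∀
  touches : p + c ≤ p + b + + 2 * w + + 3 + + 1
  touches = ≤-by _ (gap g≤ ⊕ gap step ⊕ nat 1) (slack p w g b c)

-- The set A = L ∪ R has this
-- layout with c = 0 and M = 2n, the new set A' with M = 2n + c.
record Layout (n M c : ℤ) (L R X : List ℤ) : Set where
  field
    bounds : ∀ {x} → x ∈ X → (+ 1 ≤ x) × (x ≤ M)
    low    : ∀ {x} → x ∈ X → x ≤ n → x ∈ L
    high   : ∀ {x} → x ∈ X → M - n < x → ∃ λ r → (r ∈ R) × (x ≡ r + c)

module _ {n M c : ℤ} {L R X : List ℤ} (layout : Layout n M c L R X) where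
  open Layout layout

  private
    diff-above : ∀ u v M → (u - v) - (+ 1 - M) ≡ (u - + 1) + (M - v)
    diff-above = solve-∀
    diff-below : ∀ u v M → (M - + 1) - (u - v) ≡ (M - u) + (v - + 1)
    diff-below = solve-∀
    sum-above : ∀ u v → (u + v) - + 2 ≡ (u - + 1) + (v - + 1)
    sum-above = solve-∀
    sum-below : ∀ u v M → + 2 * M - (u + v) ≡ (M - u) + (M - v)
    sum-below = solve-∀
    diff-v-high : ∀ n M u v → v - (+ 1 + (M - n)) ≡ (u - + 1) + ((n - M) - (u - v))
    diff-v-high = solve-∀
    diff-u-low : ∀ n M u v → n - u ≡ ((n - M) - (u - v)) + (M - v)
    diff-u-low = solve-∀
    shift-cancel : ∀ u r c → (u - (r + c)) + c ≡ u - r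
    shift-cancel = solve-∀
    neg-low : ∀ n M x → (n - M) - ℤ.- x ≡ x - (M - n)
    neg-low = solve-∀
    neg-shift : ∀ x c → x - c ≡ ℤ.- (ℤ.- x + c)
    neg-shift = solve-∀
    neg-diff : ∀ u r → ℤ.- (u - r) ≡ r - u
    neg-diff = solve-∀
    sum-u-low : ∀ n u v → n - u ≡ ((n + + 1) - (u + v)) + (v - + 1)
    sum-u-low = solve-∀
    sum-v-low : ∀ n u v → n - v ≡ ((n + + 1) - (u + v)) + (u - + 1)
    sum-v-low = solve-∀
    sum-u-high : ∀ n M u v → u - (+ 1 + (M - n)) ≡ ((u + v) - (+ 1 + (+ 2 * M - n))) + (M - v)
    sum-u-high = solve-∀
    sum-v-high : ∀ n M u v → v - (+ 1 + (M - n)) ≡ ((u + v) - (+ 1 + (+ 2 * M - n))) + (M - u)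
    sum-v-high = solve-∀

  diffset-bounds : ∀ {x} → x ∈ diffset X → (+ 1 - M ≤ x) × (x ≤ M - + 1)
  diffset-bounds x∈ with ∈diffset⁻ {X} x∈
  ... | u , v , u∈ , v∈ , refl =
    ≤-by _ (gap (proj₁ (bounds u∈)) ⊕ gap (proj₂ (bounds v∈))) (diff-above u v M) ,
    ≤-by _ (gap (proj₂ (bounds u∈)) ⊕ gap (proj₁ (bounds v∈))) (diff-below u v M)

  sumset-bounds : ∀ {s} → s ∈ sumset X → (+ 2 ≤ s) × (s ≤ + 2 * M)
  sumset-bounds s∈ with ∈sumset⁻ {X} s∈
  ... | u , v , u∈ , v∈ , refl =
    ≤-by _ (gap (proj₁ (bounds u∈)) ⊕ gap (proj₁ (bounds v∈))) (sum-above u v) ,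
    ≤-by _ (gap (proj₂ (bounds u∈)) ⊕ gap (proj₂ (bounds v∈))) (sum-below u v M)

  diff-low : ∀ {x} → x ∈ diffset X → x ≤ n - M → ∃₂ λ u r → (u ∈ L) × (r ∈ R) × (x + c ≡ u - r)
  diff-low {x} x∈ x≤ with ∈diffset⁻ {X} x∈
  ... | u , v , u∈ , v∈ , refl with high v∈ (<-by _ (gap (proj₁ (bounds u∈)) ⊕ gap x≤) (diff-v-high n M u v))
  ... | r , r∈ , refl = u , r , low u∈ (≤-by _ (gap x≤ ⊕ gap (proj₂ (bounds v∈))) (diff-u-low n M u (r + c)))
                          , r∈ , shift-cancel u r c

  diff-high : ∀ {x} → x ∈ diffset X → M - n ≤ x → ∃₂ λ u r → (u ∈ L) × (r ∈ R) × (x - c ≡ r - u)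
  diff-high {x} x∈ x≥ with diff-low (diffset-neg {X} x∈) (≤-by _ (gap x≥) (neg-low n M x))
  ... | u , r , u∈ , r∈ , eq = u , r , u∈ , r∈ , trans (neg-shift x c) (trans (cong ℤ.-_ eq) (neg-diff u r))

  sum-low : ∀ {s} → s ∈ sumset X → s ≤ n + + 1 → s ∈ sumset L
  sum-low {s} s∈ s≤ with ∈sumset⁻ {X} s∈
  ... | u , v , u∈ , v∈ , refl =
    ∈sumset⁺ {L} (low u∈ (≤-by _ (gap s≤ ⊕ gap (proj₁ (bounds v∈))) (sum-u-low n u v)))
                 (low v∈ (≤-by _ (gap s≤ ⊕ gap (proj₁ (bounds u∈))) (sum-v-low n u v))) refl

  sum-high : ∀ {s} → s ∈ sumset X → + 2 * M - n < s → ∃₂ λ r r' → (r ∈ R) × (r' ∈ R) × (s ≡ (r + c) + (r' + c))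
  sum-high {s} s∈ s> with ∈sumset⁻ {X} s∈
  ... | u , v , u∈ , v∈ , refl
      with high u∈ (<-by _ (gap< s> ⊕ gap (proj₂ (bounds v∈))) (sum-u-high n M u v))
         | high v∈ (<-by _ (gap< s> ⊕ gap (proj₂ (bounds u∈))) (sum-v-high n M u v))
  ... | r , r∈ , refl | r' , r'∈ , refl = r , r' , r∈ , r'∈ , refl

middle-swap : ∀ x₁ x₃ y₁ y₃ ℓ ℓ' → x₁ ℕ.+ ℓ ℕ.+ x₃ ℕ.< y₁ ℕ.+ ℓ ℕ.+ y₃ → x₁ ℕ.+ ℓ' ℕ.+ x₃ ℕ.< y₁ ℕ.+ ℓ' ℕ.+ y₃
middle-swap x₁ x₃ y₁ y₃ ℓ ℓ' lt =
  subst₂ ℕ._<_ (sym (to-front x₁ ℓ' x₃)) (sym (to-front y₁ ℓ' y₃))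
    (ℕP.+-monoʳ-< ℓ' (ℕP.+-cancelˡ-< ℓ (x₁ ℕ.+ x₃) (y₁ ℕ.+ y₃)
      (subst₂ ℕ._<_ (to-front x₁ ℓ x₃) (to-front y₁ ℓ y₃) lt)))
  where
  to-front : ∀ a ℓ b → a ℕ.+ ℓ ℕ.+ b ≡ ℓ ℕ.+ (a ℕ.+ b)
  to-front a ℓ b = trans (cong (ℕ._+ b) (ℕP.+-comm a ℓ)) (ℕP.+-assoc ℓ a b)

module Construction
  (n k m : ℤ) (L R M : List ℤ)
  (n≥1 : + 1 ≤ n)
  (A-mstd : MSTD (L ++ R)) (A-Pn : P n (L ++ R))
  (L-range : All (λ x → (+ 1 ≤ x) × (x ≤ n)) L)
  (R-range : All (λ x → (n + + 1 ≤ x) × (x ≤ + 2 * n)) R)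
  (L-start : ∀ x → + 1 ≤ x → x ≤ + 4 → x ∈ L) (n∈L : n ∈ L)
  (n+1∈R : n + + 1 ∈ R) (R-end : ∀ x → + 2 * n - + 3 ≤ x → x ≤ + 2 * n → x ∈ R)
  (k-large : n + + 4 ≤ + 2 * k) (m≥0 : + 0 ≤ m)
  (M-range : All (λ x → (n + + 2 * k + + 3 ≤ x) × (x ≤ n + m + + 2 * k + + 2)) M)
  (t : ℕ) (xs : Fin (suc t) → ℤ)
  (xs-pairs : ∀ j → (xs j ∈ M) × (xs j + + 1 ∈ M))
  (xs-steps : ∀ (j : Fin t) → xs (fsuc j) - xs (inject₁ j) ≤ + 2 * k - + 1)
  (x₀-high : xs zero + + 1 ≤ n + + 4 * k + + 1)
  (xₜ-low : n + m + + 4 ≤ xs (fromℕ t))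
  where

  c N w : ℤ
  c = m + + 4 * k + + 4
  N = + 2 * n + c
  w = k - + 2

  A A' : List ℤ
  A  = L ++ R
  A' = L ++ O₁ n k ++ M ++ O₂ n k m ++ shift R c

  n≥0 : NonNeg n
  n≥0 = ℤP.≤-trans (+≤+ z≤n) n≥1

  -- 2k ≥ n + 4 ≥ 5 forces k ≥ 2, i.e. the combs have non-negative width.
  w≥0 : NonNeg w
  w≥0 with + 2 ℤP.≤? k
  ... | yes 2≤k = gap 2≤k
  ... | no  2≰k = ⊥-elim (impossible-by (gap k-large ⊕ gap n≥1 ⊕ scale 2 (gap< (ℤP.≰⇒> 2≰k)) ⊕ nat 2)
                                        (too-small n k))
    where
    too-small : ∀ n k → ((+ 2 * k) - (n + + 4)) + (n - + 1) + + 2 * (+ 2 - (+ 1 + k)) + + 2 + + 1 ≡ + 0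
    too-small = solve-∀

  c≥0 : NonNeg c
  c≥0 = subst NonNeg (c-via-w m k) (m≥0 ⊕ scale 4 w≥0 ⊕ nat 12)
    where
    c-via-w : ∀ m k → m + + 4 * (k - + 2) + + 12 ≡ m + + 4 * k + + 4
    c-via-w = solve-∀

  L⊆A' : ∀ {z} → z ∈ L → z ∈ A'
  L⊆A' = ∈-++⁺ˡ

  O₁⊆A' : ∀ {z} → z ∈ O₁ n k → z ∈ A'
  O₁⊆A' z∈ = ∈-++⁺ʳ L (∈-++⁺ˡ z∈)

  M⊆A' : ∀ {z} → z ∈ M → z ∈ A'
  M⊆A' z∈ = ∈-++⁺ʳ L (∈-++⁺ʳ (O₁ n k) (∈-++⁺ˡ z∈))

  O₂⊆A' : ∀ {z} → z ∈ O₂ n k m → z ∈ A'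
  O₂⊆A' z∈ = ∈-++⁺ʳ L (∈-++⁺ʳ (O₁ n k) (∈-++⁺ʳ M (∈-++⁺ˡ z∈)))

  R+c⊆A' : ∀ {r} → r ∈ R → r + c ∈ A'
  R+c⊆A' r∈ = ∈-++⁺ʳ L (∈-++⁺ʳ (O₁ n k) (∈-++⁺ʳ M (∈-++⁺ʳ (O₂ n k m) (∈-map⁺ (λ x → x + c) r∈))))

  Middle : ℤ → Set
  Middle z = (n + + 4 ≤ z) × (z ≤ n + m + + 4 * k + + 1)

  private
    within : ∀ {lo hi z} → n + + 4 ≤ lo → hi ≤ n + m + + 4 * k + + 1 → lo ≤ z → z ≤ hi → Middle z
    within n+4≤lo hi≤top lo≤z z≤hi = ℤP.≤-trans n+4≤lo lo≤z , ℤP.≤-trans z≤hi hi≤top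

    O₁-start : ∀ n m k → (n + m + + 4 * k + + 1) - (n + + 4) ≡ m + + 4 * (k - + 2) + + 5
    O₁-start = solve-∀
    O₁-teeth-lo : ∀ n → (n + + 5) - (n + + 4) ≡ + 1
    O₁-teeth-lo = solve-∀
    O₁-teeth-hi : ∀ n m k → (n + m + + 4 * k + + 1) - (n + + 2 * k + + 1) ≡ m + + 2 * (k - + 2) + + 4
    O₁-teeth-hi = solve-∀
    O₁-end-lo : ∀ n k → (n + + 2 * k + + 2) - (n + + 4) ≡ + 2 * (k - + 2) + + 2
    O₁-end-lo = solve-∀
    O₁-end-hi : ∀ n m k → (n + m + + 4 * k + + 1) - (n + + 2 * k + + 2) ≡ m + + 2 * (k - + 2) + + 3
    O₁-end-hi = solve-∀
    M-lo : ∀ n k → (n + + 2 * k + + 3) - (n + + 4) ≡ + 2 * (k - + 2) + + 3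
    M-lo = solve-∀
    M-hi : ∀ n m k → (n + m + + 4 * k + + 1) - (n + m + + 2 * k + + 2) ≡ + 2 * (k - + 2) + + 3
    M-hi = solve-∀
    O₂-start-lo : ∀ n m k → (n + m + + 2 * k + + 3) - (n + + 4) ≡ m + + 2 * (k - + 2) + + 3
    O₂-start-lo = solve-∀
    O₂-start-hi : ∀ n m k → (n + m + + 4 * k + + 1) - (n + m + + 2 * k + + 3) ≡ + 2 * (k - + 2) + + 2
    O₂-start-hi = solve-∀
    O₂-teeth-lo : ∀ n m k → (n + m + + 2 * k + + 4) - (n + + 4) ≡ m + + 2 * (k - + 2) + + 4
    O₂-teeth-lo = solve-∀
    O₂-teeth-hi : ∀ n m k → (n + m + + 4 * k + + 1) - (n + m + + 4 * k) ≡ + 1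
    O₂-teeth-hi = solve-∀

  O₁-middle : ∀ {z} → z ∈ O₁ n k → Middle z
  O₁-middle (here refl) = ℤP.≤-refl , ≤-by _ (m≥0 ⊕ scale 4 w≥0 ⊕ nat 5) (O₁-start n m k)
  O₁-middle (there z∈) with ∈-++⁻ (interval₂ (n + + 5) (n + + 2 * k + + 1)) z∈
  ... | inj₁ z∈I = let (lo , hi) = ∈interval₂⁻ _ _ _ z∈I in
    within (≤-by _ (nat 1) (O₁-teeth-lo n)) (≤-by _ (m≥0 ⊕ scale 2 w≥0 ⊕ nat 4) (O₁-teeth-hi n m k)) lo hi
  ... | inj₂ (here refl) =
    ≤-by _ (scale 2 w≥0 ⊕ nat 2) (O₁-end-lo n k) , ≤-by _ (m≥0 ⊕ scale 2 w≥0 ⊕ nat 3) (O₁-end-hi n m k)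

  M-middle : ∀ {z} → z ∈ M → Middle z
  M-middle z∈ = let (lo , hi) = All.lookup M-range z∈ in
    within (≤-by _ (scale 2 w≥0 ⊕ nat 3) (M-lo n k)) (≤-by _ (scale 2 w≥0 ⊕ nat 3) (M-hi n m k)) lo hi

  O₂-middle : ∀ {z} → z ∈ O₂ n k m → Middle z
  O₂-middle (here refl) =
    ≤-by _ (m≥0 ⊕ scale 2 w≥0 ⊕ nat 3) (O₂-start-lo n m k) , ≤-by _ (scale 2 w≥0 ⊕ nat 2) (O₂-start-hi n m k)
  O₂-middle (there z∈) with ∈-++⁻ (interval₂ (n + m + + 2 * k + + 4) (n + m + + 4 * k)) z∈
  ... | inj₁ z∈I = let (lo , hi) = ∈interval₂⁻ _ _ _ z∈I in
    within (≤-by _ (m≥0 ⊕ scale 2 w≥0 ⊕ nat 4) (O₂-teeth-lo n m k)) (≤-by _ (nat 1) (O₂-teeth-hi n m k)) lo hi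
  ... | inj₂ (here refl) = ≤-by _ (m≥0 ⊕ scale 4 w≥0 ⊕ nat 5) (O₁-start n m k) , ℤP.≤-refl

  data Part (z : ℤ) : Set where
    in-L      : z ∈ L → Part z
    in-middle : Middle z → Part z
    in-R      : ∀ r → r ∈ R → z ≡ r + c → Part z

  classify : ∀ {z} → z ∈ A' → Part z
  classify z∈ with ∈-++⁻ L z∈
  ... | inj₁ z∈L = in-L z∈L
  ... | inj₂ z∈₁ with ∈-++⁻ (O₁ n k) z∈₁
  ... | inj₁ z∈O₁ = in-middle (O₁-middle z∈O₁)
  ... | inj₂ z∈₂ with ∈-++⁻ M z∈₂
  ... | inj₁ z∈M = in-middle (M-middle z∈M)
  ... | inj₂ z∈₃ with ∈-++⁻ (O₂ n k m) z∈₃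
  ... | inj₁ z∈O₂ = in-middle (O₂-middle z∈O₂)
  ... | inj₂ z∈R+c with ∈-map⁻ (λ x → x + c) z∈R+c
  ... | r , r∈ , z≡ = in-R r r∈ z≡

  private
    N-above-L : ∀ n m k z → (+ 2 * n + (m + + 4 * k + + 4)) - z ≡ (n - z) + n + (m + + 4 * k + + 4)
    N-above-L = solve-∀
    middle-above-1 : ∀ n → (n + + 4) - + 1 ≡ n + + 3
    middle-above-1 = solve-∀
    N-above-middle : ∀ n m k → (+ 2 * n + (m + + 4 * k + + 4)) - (n + m + + 4 * k + + 1) ≡ n + + 3
    N-above-middle = solve-∀
    R+c-above-1 : ∀ n r c → (r + c) - + 1 ≡ (r - (n + + 1)) + n + c
    R+c-above-1 = solve-∀
    R+c-below-N : ∀ n r c → (+ 2 * n + c) - (r + c) ≡ + 2 * n - r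
    R+c-below-N = solve-∀
    middle-not-low : ∀ n z → (n - z) + (z - (n + + 4)) + + 3 + + 1 ≡ + 0
    middle-not-low = solve-∀
    R+c-not-low : ∀ n r c z → (n - z) + (r - (n + + 1)) + (z - (r + c)) + c + + 1 ≡ + 0
    R+c-not-low = solve-∀
    L-not-high : ∀ n c z → (z - (+ 1 + ((+ 2 * n + c) - n))) + (n - z) + c + + 1 ≡ + 0
    L-not-high = solve-∀
    middle-not-high : ∀ n m k z →
      (z - (+ 1 + ((+ 2 * n + (m + + 4 * k + + 4)) - n))) + ((n + m + + 4 * k + + 1) - z) + + 3 + + 1 ≡ + 0
    middle-not-high = solve-∀
    2n-above-L : ∀ n z → + 2 * n - z ≡ (n - z) + n
    2n-above-L = solve-∀
    R-above-1 : ∀ n r → r - + 1 ≡ (r - (n + + 1)) + n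
    R-above-1 = solve-∀
    R-not-low : ∀ n z → (n - z) + (z - (n + + 1)) + + 1 ≡ + 0
    R-not-low = solve-∀
    L-not-high' : ∀ n z → (z - (+ 1 + (+ 2 * n - n))) + (n - z) + + 1 ≡ + 0
    L-not-high' = solve-∀

  layout-A' : Layout n N c L R A'
  layout-A' = record { bounds = bounds ; low = low ; high = high }
    where
    bounds : ∀ {z} → z ∈ A' → (+ 1 ≤ z) × (z ≤ N)
    bounds {z} z∈ with classify z∈
    ... | in-L z∈L = let (lo , hi) = All.lookup L-range z∈L in
      lo , ≤-by _ (gap hi ⊕ n≥0 ⊕ c≥0) (N-above-L n m k z)
    ... | in-middle (lo , hi) =
      ℤP.≤-trans (≤-by _ (n≥0 ⊕ nat 3) (middle-above-1 n)) lo ,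
      ℤP.≤-trans hi (≤-by _ (n≥0 ⊕ nat 3) (N-above-middle n m k))
    ... | in-R r r∈ refl = let (lo , hi) = All.lookup R-range r∈ in
      ≤-by _ (gap lo ⊕ n≥0 ⊕ c≥0) (R+c-above-1 n r c) , ≤-by _ (gap hi) (R+c-below-N n r c)
    low : ∀ {z} → z ∈ A' → z ≤ n → z ∈ L
    low {z} z∈ low-z with classify z∈
    ... | in-L z∈L = z∈L
    ... | in-middle (lo , _) = ⊥-elim (impossible-by (gap low-z ⊕ gap lo ⊕ nat 3) (middle-not-low n z))
    ... | in-R r r∈ z≡ = ⊥-elim (impossible-by
          (gap low-z ⊕ gap (proj₁ (All.lookup R-range r∈)) ⊕ gap (ℤP.≤-reflexive (sym z≡)) ⊕ c≥0)
          (R+c-not-low n r c z))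
    high : ∀ {z} → z ∈ A' → N - n < z → ∃ λ r → (r ∈ R) × (z ≡ r + c)
    high {z} z∈ z> with classify z∈
    ... | in-L z∈L = ⊥-elim (impossible-by (gap< z> ⊕ gap (proj₂ (All.lookup L-range z∈L)) ⊕ c≥0)
                                           (L-not-high n c z))
    ... | in-middle (_ , hi) = ⊥-elim (impossible-by (gap< z> ⊕ gap hi ⊕ nat 3) (middle-not-high n m k z))
    ... | in-R r r∈ z≡ = r , r∈ , z≡

  layout-A : Layout n (+ 2 * n) (+ 0) L R A
  layout-A = record { bounds = bounds ; low = low ; high = high }
    where
    bounds : ∀ {z} → z ∈ A → (+ 1 ≤ z) × (z ≤ + 2 * n)
    bounds {z} z∈ with ∈-++⁻ L z∈
    ... | inj₁ z∈L = let (lo , hi) = All.lookup L-range z∈L in lo , ≤-by _ (gap hi ⊕ n≥0) (2n-above-L n z)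
    ... | inj₂ z∈R = let (lo , hi) = All.lookup R-range z∈R in ≤-by _ (gap lo ⊕ n≥0) (R-above-1 n z) , hi
    low : ∀ {z} → z ∈ A → z ≤ n → z ∈ L
    low {z} z∈ low-z with ∈-++⁻ L z∈
    ... | inj₁ z∈L = z∈L
    ... | inj₂ z∈R = ⊥-elim (impossible-by (gap low-z ⊕ gap (proj₁ (All.lookup R-range z∈R))) (R-not-low n z))
    high : ∀ {z} → z ∈ A → + 2 * n - n < z → ∃ λ r → (r ∈ R) × (z ≡ r + + 0)
    high {z} z∈ z> with ∈-++⁻ L z∈
    ... | inj₁ z∈L = ⊥-elim (impossible-by (gap< z> ⊕ gap (proj₂ (All.lookup L-range z∈L))) (L-not-high' n z))
    ... | inj₂ z∈R = _ , z∈R , sym (ℤP.+-identityʳ _)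

  -- The
  -- combs O₁ (at p₁) and O₂ (at p₂) are added to chains of pairs with steps at
  -- most g = 2k - 1 = 2w + 3 running through 1, 3, O₁, the pairs xⱼ of M,
  -- O₂ and the top of R + c; n + {2, 3, 4} and n + 1 + c + [2n - 3, 2n] + c
  -- fill the two ends.
  p₁ p₂ g : ℤ
  p₁ = n + + 4
  p₂ = n + m + + 2 * k + + 3
  g  = + 2 * k - + 1

  private
    g-is-2w+3 : ∀ k → (+ 2 * (k - + 2) + + 3) - (+ 2 * k - + 1) ≡ + 0
    g-is-2w+3 = solve-∀
    O₁-a : ∀ n → n + + 5 ≡ (n + + 4) + + 1
    O₁-a = solve-∀
    O₁-b : ∀ n k → n + + 2 * k + + 1 ≡ (n + + 4) + + 1 + + 2 * (k - + 2)
    O₁-b = solve-∀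
    O₁-l : ∀ n k → n + + 2 * k + + 2 ≡ (n + + 4) + + 2 * (k - + 2) + + 2
    O₁-l = solve-∀
    O₂-a : ∀ n m k → n + m + + 2 * k + + 4 ≡ (n + m + + 2 * k + + 3) + + 1
    O₂-a = solve-∀
    O₂-b : ∀ n m k → n + m + + 4 * k ≡ (n + m + + 2 * k + + 3) + + 1 + + 2 * (k - + 2)
    O₂-b = solve-∀
    O₂-l : ∀ n m k → n + m + + 4 * k + + 1 ≡ (n + m + + 2 * k + + 3) + + 2 * (k - + 2) + + 2
    O₂-l = solve-∀

  g-fits : g ≤ + 2 * w + + 3
  g-fits = ≤-by _ (nat 0) (g-is-2w+3 k)

  comb₁ : Comb A' p₁ w
  comb₁ = comb-mono O₁⊆A' (comb-list w w≥0 (O₁-a n) (O₁-b n k) (O₁-l n k))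

  comb₂ : Comb A' p₂ w
  comb₂ = comb-mono O₂⊆A' (comb-list w w≥0 (O₂-a n m k) (O₂-b n m k) (O₂-l n m k))

  L-run : ∀ i → i ℕ.≤ 3 → + 1 + + i ∈ A'
  L-run i i≤3 = L⊆A' (L-start (+ 1 + + i) (≤-by _ (nat i) (above (+ i))) (≤-by _ (gap (+≤+ i≤3)) (below (+ i))))
    where
    above : ∀ i → (+ 1 + i) - + 1 ≡ i
    above = solve-∀
    below : ∀ i → + 4 - (+ 1 + i) ≡ + 3 - i
    below = solve-∀

  top : ℤ
  top = (+ 2 * n - + 3) + c

  top-run : ∀ i → i ℕ.≤ 3 → top + + i ∈ A'
  top-run i i≤3 = subst (_∈ A') (regroup (+ 2 * n - + 3) c (+ i))
    (R+c⊆A' (R-end _ (≤-by _ (nat i) (above (+ 2 * n) (+ i))) (≤-by _ (gap (+≤+ i≤3)) (below (+ 2 * n) (+ i)))))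
    where
    regroup : ∀ a c i → (a + i) + c ≡ (a + c) + i
    regroup = solve-∀
    above : ∀ b i → (b - + 3 + i) - (b - + 3) ≡ i
    above = solve-∀
    below : ∀ b i → b - (b - + 3 + i) ≡ + 3 - i
    below = solve-∀

  private
    run-pair : ∀ s → (∀ i → i ℕ.≤ 3 → s + + i ∈ A') → ∀ j → j ℕ.≤ 2 → PairChain A' g (s + + j) (s + + j)
    run-pair s run j j≤2 = pair (run j (ℕP.m≤n⇒m≤1+n j≤2))
      (subst (_∈ A') (sym (ℤP.+-assoc s (+ j) (+ 1))) (run (j ℕ.+ 1) (subst (ℕ._≤ 3) (ℕP.+-comm 1 j) (s≤s j≤2))))

  x₀ xₜ : ℤ
  x₀ = xs zero
  xₜ = xs (fromℕ t)

  private
    step-1-3 : ∀ k → (+ 2 * k - + 1) - (+ 1 + + 2 - + 1) ≡ + 2 * (k - + 2) + + 1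
    step-1-3 = solve-∀
    step-3-p₁ : ∀ n k → (+ 2 * k - + 1) - ((n + + 4) - (+ 1 + + 2)) ≡ ((+ 2 * k) - (n + + 4)) + + 2
    step-3-p₁ = solve-∀
    step-comb : ∀ p k → (+ 2 * k - + 1) - ((p + + 1 + + 2 * (k - + 2)) - p) ≡ + 2
    step-comb = solve-∀
    step-O₁-x₀ : ∀ n k x → (+ 2 * k - + 1) - (x - ((n + + 4) + + 1 + + 2 * (k - + 2))) ≡ (n + + 4 * k + + 1) - (x + + 1)
    step-O₁-x₀ = solve-∀
    step-xₜ-O₂ : ∀ n m k x → (+ 2 * k - + 1) - ((n + m + + 2 * k + + 3) - x) ≡ x - (n + m + + 4)
    step-xₜ-O₂ = solve-∀
    step-O₂-top : ∀ n m k → (+ 2 * k - + 1) - (((+ 2 * n - + 3) + (m + + 4 * k + + 4) + + 0)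
                    - ((n + m + + 2 * k + + 3) + + 1 + + 2 * (k - + 2))) ≡ ((+ 2 * k) - (n + + 4)) + + 2
    step-O₂-top = solve-∀
    step-top : ∀ s k → (+ 2 * k - + 1) - ((s + + 2) - (s + + 0)) ≡ + 2 * (k - + 2) + + 1
    step-top = solve-∀

  xs-chain : PairChain A' g x₀ xₜ
  xs-chain = sequence-chain t xs (λ j → M⊆A' (proj₁ (xs-pairs j)) , M⊆A' (proj₂ (xs-pairs j))) xs-steps

  comb-first : ∀ {p} → Comb A' p w → PairChain A' g p p
  comb-first comb = let (p∈ , p+1∈) = comb-first-pair w≥0 comb in pair p∈ p+1∈

  comb-last : ∀ {p} → Comb A' p w → PairChain A' g (p + + 1 + + 2 * w) (p + + 1 + + 2 * w)
  comb-last comb = let (q∈ , q+1∈) = comb-last-pair w≥0 comb in pair q∈ q+1∈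

  middle-chain : PairChain A' g p₁ xₜ
  middle-chain =
    comb-first comb₁ ⟶⟨ ≤-by _ (nat 2) (step-comb p₁ k) ⟩
    comb-last comb₁  ⟶⟨ ≤-by _ (gap x₀-high) (step-O₁-x₀ n k x₀) ⟩
    xs-chain

  left-chain : PairChain A' g (+ 1) xₜ
  left-chain =
    run-pair (+ 1) L-run 0 z≤n            ⟶⟨ ≤-by _ (scale 2 w≥0 ⊕ nat 1) (step-1-3 k) ⟩
    run-pair (+ 1) L-run 2 (s≤s (s≤s z≤n)) ⟶⟨ ≤-by _ (gap k-large ⊕ nat 2) (step-3-p₁ n k) ⟩
    middle-chain

  right-chain : PairChain A' g p₁ (top + + 2)
  right-chain =
    middle-chain ⟶⟨ ≤-by _ (gap xₜ-low) (step-xₜ-O₂ n m k xₜ) ⟩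
    comb-first comb₂ ⟶⟨ ≤-by _ (nat 2) (step-comb p₂ k) ⟩
    comb-last comb₂  ⟶⟨ ≤-by _ (gap k-large ⊕ nat 2) (step-O₂-top n m k) ⟩
    run-pair top top-run 0 z≤n ⟶⟨ ≤-by _ (scale 2 w≥0 ⊕ nat 1) (step-top top k) ⟩
    run-pair top top-run 2 (s≤s (s≤s z≤n))

  private
    join-0-1 : ∀ n → (n + + 2 + + 2 + + 1) - ((n + + 4) + + 1) ≡ + 0
    join-0-1 = solve-∀
    join-1-2 : ∀ n m k x → ((n + + 4) + x + + 2 * (k - + 2) + + 3 + + 1) - ((n + m + + 2 * k + + 3) + (n + + 4))
               ≡ (x - (n + m + + 4)) + + 1
    join-1-2 = solve-∀
    join-2-3 : ∀ n m k → ((n + m + + 2 * k + + 3) + ((+ 2 * n - + 3) + (m + + 4 * k + + 4) + + 2) + + 2 * (k - + 2) + + 3 + + 1)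
               - ((n + + 1) + (m + + 4 * k + + 4) + ((+ 2 * n - + 3) + (m + + 4 * k + + 4))) ≡ + 0
    join-2-3 = solve-∀
    reaches-end : ∀ n m k → ((n + + 1) + (m + + 4 * k + + 4) + ((+ 2 * n - + 3) + (m + + 4 * k + + 4)) + + 3)
                  - (+ 2 * (+ 2 * n + (m + + 4 * k + + 4)) - n) ≡ + 1
    reaches-end = solve-∀

  middle-covered : Covers A' (n + + 2) (+ 2 * N - n)
  middle-covered = covers-shrink
    (covers-run 2 (L⊆A' n∈L) (λ i i≤2 → L-run (suc i) (s≤s i≤2))
       ∪⟨ ≤-by _ (nat 0) (join-0-1 n) ⟩
     comb+chain w≥0 g-fits comb₁ left-chain
       ∪⟨ ≤-by _ (gap xₜ-low ⊕ nat 1) (join-1-2 n m k xₜ) ⟩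
     comb+chain w≥0 g-fits comb₂ right-chain
       ∪⟨ ≤-by _ (nat 0) (join-2-3 n m k) ⟩
     covers-run 3 (R+c⊆A' n+1∈R) top-run)
    (≤-by _ (nat 1) (reaches-end n m k))

  -- A - A and A' + A' are split into a left window of length n, a
  -- middle window, and a right window of length n; the middle windows of
  -- A - A (length ℓ = 2n - 1, by P_n) and of A' + A' (length ℓ' = 2N - 2n - 1)
  -- are full.
  D D' S S' : List ℤ
  D  = diffset A
  D' = diffset A'
  S  = sumset A
  S' = sumset A'

  n₀ ℓ ℓ' : ℕ
  n₀ = ∣ n ∣
  ℓ  = ∣ + 2 * n - + 1 ∣
  ℓ' = ∣ + 2 * N - + 2 * n - + 1 ∣

  private
    ℓ-via-n : ∀ n → + 2 * n - + 1 ≡ (n - + 1) + n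
    ℓ-via-n = solve-∀
    ℓ'-via-n : ∀ n c → + 2 * (+ 2 * n + c) - + 2 * n - + 1 ≡ (n - + 1) + n + + 2 * c
    ℓ'-via-n = solve-∀

  n₀≡ : + n₀ ≡ n
  n₀≡ = ℤP.0≤i⇒+∣i∣≡i n≥0

  ℓ≡ : + ℓ ≡ + 2 * n - + 1
  ℓ≡ = ℤP.0≤i⇒+∣i∣≡i (subst NonNeg (sym (ℓ-via-n n)) (gap n≥1 ⊕ n≥0))

  ℓ'≡ : + ℓ' ≡ + 2 * N - + 2 * n - + 1
  ℓ'≡ = ℤP.0≤i⇒+∣i∣≡i (subst NonNeg (sym (ℓ'-via-n n c)) (gap n≥1 ⊕ n≥0 ⊕ scale 2 c≥0))

  i<n : ∀ {i} → i ℕ.< n₀ → + i < n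
  i<n {i} i<n₀ = subst (+ i <_) n₀≡ (ℤ.+<+ i<n₀)

  X₁ X₃ Y₁ Y₃ : ℕ
  X₁ = count D (+ 1 - + 2 * n) n₀
  X₃ = count D n n₀
  Y₁ = count S (+ 2) n₀
  Y₃ = count S (+ 3 * n + + 1) n₀

  private
    through : ∀ {l e} a b → + l ≡ e → a + (n + e) ≡ b → a + + (n₀ ℕ.+ l) ≡ b
    through a b l≡ eq = trans (cong (λ d → a + d) (cong₂ _+_ n₀≡ l≡)) eq
    through₃ : ∀ {l e} a b → + l ≡ e → a + (n + e + n) ≡ b → a + + (n₀ ℕ.+ l ℕ.+ n₀) ≡ b
    through₃ a b l≡ eq = trans (cong (λ d → a + d) (cong₂ _+_ (cong₂ _+_ n₀≡ l≡) n₀≡)) eq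
    D-right-identity : ∀ n → (+ 1 - + 2 * n) + (n + (+ 2 * n - + 1)) ≡ n
    D-right-identity = solve-∀
    D'-right-identity : ∀ n c → (+ 1 - (+ 2 * n + c)) + (n + (+ 2 * (+ 2 * n + c) - + 2 * n - + 1)) ≡ (+ 2 * n + c) - n
    D'-right-identity = solve-∀
    D'-end-identity : ∀ n c → (+ 1 - (+ 2 * n + c)) + (n + (+ 2 * (+ 2 * n + c) - + 2 * n - + 1) + n) ≡ (+ 2 * n + c)
    D'-end-identity = solve-∀
    S-right-identity : ∀ n → + 2 + (n + (+ 2 * n - + 1)) ≡ + 3 * n + + 1
    S-right-identity = solve-∀
    S-end-identity : ∀ n → + 2 + (n + (+ 2 * n - + 1) + n) ≡ + 4 * n + + 1
    S-end-identity = solve-∀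
    S'-right-identity : ∀ n c → + 2 + (n + (+ 2 * (+ 2 * n + c) - + 2 * n - + 1)) ≡ + 2 * (+ 2 * n + c) - n + + 1
    S'-right-identity = solve-∀

  D-right-base : (+ 1 - + 2 * n) + + (n₀ ℕ.+ ℓ) ≡ n
  D-right-base = through (+ 1 - + 2 * n) _ ℓ≡ (D-right-identity n)

  D'-right-base : (+ 1 - N) + + (n₀ ℕ.+ ℓ') ≡ N - n
  D'-right-base = through (+ 1 - N) _ ℓ'≡ (D'-right-identity n c)

  S-right-base : + 2 + + (n₀ ℕ.+ ℓ) ≡ + 3 * n + + 1
  S-right-base = through (+ 2) _ ℓ≡ (S-right-identity n)

  S'-right-base : + 2 + + (n₀ ℕ.+ ℓ') ≡ + 2 * N - n + + 1
  S'-right-base = through (+ 2) _ ℓ'≡ (S'-right-identity n c)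

  D'-end : (+ 1 - N) + + (n₀ ℕ.+ ℓ' ℕ.+ n₀) ≡ N
  D'-end = through₃ (+ 1 - N) _ ℓ'≡ (D'-end-identity n c)

  S-end : + 2 + + (n₀ ℕ.+ ℓ ℕ.+ n₀) ≡ + 4 * n + + 1
  S-end = through₃ (+ 2) _ ℓ≡ (S-end-identity n)

  private
    left-shift : ∀ n c i → (+ 1 - + 2 * n) + i ≡ ((+ 1 - (+ 2 * n + c)) + i) + c
    left-shift = solve-∀
    left-low : ∀ n c i → (n - (+ 2 * n + c)) - ((+ 1 - (+ 2 * n + c)) + i) ≡ n - (+ 1 + i)
    left-low = solve-∀
    right-shift : ∀ n c i → n + i ≡ (((+ 2 * n + c) - n) + i) - c
    right-shift = solve-∀
    right-high : ∀ N n i → ((N - n) + i) - (N - n) ≡ i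
    right-high = solve-∀
    sum-left-low : ∀ n i → (n + + 1) - (+ 2 + i) ≡ n - (+ 1 + i)
    sum-left-low = solve-∀
    sum-right-high : ∀ n i → ((+ 3 * n + + 1) + i) - (+ 1 + (+ 2 * (+ 2 * n) - n)) ≡ i
    sum-right-high = solve-∀
    sum-right-shift : ∀ n c i → (+ 2 * (+ 2 * n + c) - n + + 1) + i ≡ ((+ 3 * n + + 1) + i) + + 2 * c
    sum-right-shift = solve-∀
    sum-regroup : ∀ r r' c → ((r + + 0) + (r' + + 0)) + + 2 * c ≡ (r + c) + (r' + c)
    sum-regroup = solve-∀
    P-low : ∀ n i → ((+ 1 - + 2 * n) + n + i) - ((+ 1 - + 2 * n) + n) ≡ i
    P-low = solve-∀
    P-high : ∀ n i → ((+ 2 * n - + 1) - n) - ((+ 1 - + 2 * n) + n + i) ≡ (+ 2 * n - + 1) - (+ 1 + i)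
    P-high = solve-∀
    S'-low : ∀ n i → (+ 2 + n + i) - (n + + 2) ≡ i
    S'-low = solve-∀
    S'-high : ∀ n N i → (+ 2 * N - n) - (+ 2 + n + i) ≡ (+ 2 * N - + 2 * n - + 1) - (+ 1 + i)
    S'-high = solve-∀
    2n-3≤2n : ∀ n → + 2 * n - (+ 2 * n - + 3) ≡ + 3
    2n-3≤2n = solve-∀

  D'-left⇒D : ∀ i → i ℕ.< n₀ → (+ 1 - N) + + i ∈ D' → (+ 1 - + 2 * n) + + i ∈ D
  D'-left⇒D i i<n₀ x∈ =
    let (u , r , u∈ , r∈ , eq) = diff-low layout-A' x∈ (≤-by _ (gap< (i<n i<n₀)) (left-low n c (+ i)))
    in ∈diffset⁺ {A} (∈-++⁺ˡ u∈) (∈-++⁺ʳ L r∈) (trans (left-shift n c (+ i)) eq)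

  D'-right⇒D : ∀ i → i ℕ.< n₀ → (N - n) + + i ∈ D' → n + + i ∈ D
  D'-right⇒D i _ x∈ =
    let (u , r , u∈ , r∈ , eq) = diff-high layout-A' x∈ (≤-by _ (nat i) (right-high N n (+ i)))
    in ∈diffset⁺ {A} (∈-++⁺ʳ L r∈) (∈-++⁺ˡ u∈) (trans (right-shift n c (+ i)) eq)

  S-left⇒S' : ∀ i → i ℕ.< n₀ → + 2 + + i ∈ S → + 2 + + i ∈ S'
  S-left⇒S' i i<n₀ s∈ = sumset-mono L⊆A' (sum-low layout-A s∈ (≤-by _ (gap< (i<n i<n₀)) (sum-left-low n (+ i))))

  S-right⇒S' : ∀ i → i ℕ.< n₀ → (+ 3 * n + + 1) + + i ∈ S → (+ 2 * N - n + + 1) + + i ∈ S'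
  S-right⇒S' i _ s∈ =
    let (r , r' , r∈ , r'∈ , eq) = sum-high layout-A s∈ (<-by _ (nat i) (sum-right-high n (+ i)))
    in ∈sumset⁺ {A'} (R+c⊆A' r∈) (R+c⊆A' r'∈)
         (trans (sum-right-shift n c (+ i)) (trans (cong (_+ + 2 * c) eq) (sum-regroup r r' c)))

  A-min : IsMin (+ 1) A
  A-min = ∈-++⁺ˡ (L-start (+ 1) ℤP.≤-refl (+≤+ (s≤s z≤n))) , All.tabulate (λ z∈ → proj₁ (Layout.bounds layout-A z∈))

  A-max : IsMax (+ 2 * n) A
  A-max = ∈-++⁺ʳ L (R-end _ (≤-by _ (nat 3) (2n-3≤2n n)) ℤP.≤-refl) ,
          All.tabulate (λ z∈ → proj₂ (Layout.bounds layout-A z∈))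

  D-middle-full : ∀ i → i ℕ.< ℓ → ((+ 1 - + 2 * n) + + n₀) + + i ∈ D
  D-middle-full i i<ℓ = subst (λ b → b + + i ∈ D) (cong (λ d → (+ 1 - + 2 * n) + d) (sym n₀≡))
    (proj₂ (A-Pn (+ 1) (+ 2 * n) A-min A-max) _ (≤-by _ (nat i) (P-low n (+ i)))
      (≤-by _ (gap< (subst (+ i <_) ℓ≡ (ℤ.+<+ i<ℓ))) (P-high n (+ i))))

  S'-middle-full : ∀ i → i ℕ.< ℓ' → (+ 2 + + n₀) + + i ∈ S'
  S'-middle-full i i<ℓ' = subst (λ b → b + + i ∈ S') (cong (λ d → + 2 + d) (sym n₀≡))
    (cover middle-covered _ (≤-by _ (nat i) (S'-low n (+ i)))
      (≤-by _ (gap< (subst (+ i <_) ℓ'≡ (ℤ.+<+ i<ℓ'))) (S'-high n N (+ i))))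

  open ℕP.≤-Reasoning

  D'-upper : card D' ℕ.≤ X₁ ℕ.+ ℓ' ℕ.+ X₃
  D'-upper = begin
    card D'
      ≤⟨ card≤windows D' (+ 1 - N) n₀ ℓ' n₀ in-window ⟩
    count D' (+ 1 - N) n₀ ℕ.+ ℓ' ℕ.+ count D' ((+ 1 - N) + + (n₀ ℕ.+ ℓ')) n₀
      ≡⟨ cong (λ b → count D' (+ 1 - N) n₀ ℕ.+ ℓ' ℕ.+ count D' b n₀) D'-right-base ⟩
    count D' (+ 1 - N) n₀ ℕ.+ ℓ' ℕ.+ count D' (N - n) n₀
      ≤⟨ ℕP.+-mono-≤ (ℕP.+-monoˡ-≤ ℓ' (count-mono D' D _ _ n₀ D'-left⇒D)) (count-mono D' D _ _ n₀ D'-right⇒D) ⟩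
    X₁ ℕ.+ ℓ' ℕ.+ X₃ ∎
    where
    in-window : ∀ x → x ∈ D' → (+ 1 - N ≤ x) × (x < (+ 1 - N) + + (n₀ ℕ.+ ℓ' ℕ.+ n₀))
    in-window x x∈ = let (lo , hi) = diffset-bounds layout-A' x∈ in
      lo , subst (x <_) (sym D'-end) (<-by _ (gap hi) (below-N N x))
      where
      below-N : ∀ N x → N - (+ 1 + x) ≡ (N - + 1) - x
      below-N = solve-∀

  D-lower : X₁ ℕ.+ ℓ ℕ.+ X₃ ℕ.≤ card D
  D-lower = subst (λ b → X₁ ℕ.+ ℓ ℕ.+ count D b n₀ ℕ.≤ card D) D-right-base
    (windows≤card D (+ 1 - + 2 * n) n₀ ℓ n₀ D-middle-full)

  S-upper : card S ℕ.≤ Y₁ ℕ.+ ℓ ℕ.+ Y₃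
  S-upper = subst (λ b → card S ℕ.≤ Y₁ ℕ.+ ℓ ℕ.+ count S b n₀) S-right-base
    (card≤windows S (+ 2) n₀ ℓ n₀ in-window)
    where
    in-window : ∀ s → s ∈ S → (+ 2 ≤ s) × (s < + 2 + + (n₀ ℕ.+ ℓ ℕ.+ n₀))
    in-window s s∈ = let (lo , hi) = sumset-bounds layout-A s∈ in
      lo , subst (s <_) (sym S-end) (<-by _ (gap hi) (below-4n n s))
      where
      below-4n : ∀ n s → (+ 4 * n + + 1) - (+ 1 + s) ≡ + 2 * (+ 2 * n) - s
      below-4n = solve-∀

  S'-lower : Y₁ ℕ.+ ℓ' ℕ.+ Y₃ ℕ.≤ card S'
  S'-lower = begin
    Y₁ ℕ.+ ℓ' ℕ.+ Y₃
      ≤⟨ ℕP.+-mono-≤ (ℕP.+-monoˡ-≤ ℓ' (count-mono S S' _ _ n₀ S-left⇒S')) (count-mono S S' _ _ n₀ S-right⇒S') ⟩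
    count S' (+ 2) n₀ ℕ.+ ℓ' ℕ.+ count S' (+ 2 * N - n + + 1) n₀
      ≡⟨ cong (λ b → count S' (+ 2) n₀ ℕ.+ ℓ' ℕ.+ count S' b n₀) (sym S'-right-base) ⟩
    count S' (+ 2) n₀ ℕ.+ ℓ' ℕ.+ count S' (+ 2 + + (n₀ ℕ.+ ℓ')) n₀
      ≤⟨ windows≤card S' (+ 2) n₀ ℓ' n₀ S'-middle-full ⟩
    card S' ∎

  -- |A' - A'| ≤ X₁ + ℓ' + X₃ < Y₁ + ℓ' + Y₃ ≤ |A' + A'|, the middle inequality
  -- being |A - A| < |A + A| with the middle term ℓ replaced by ℓ'.
  A'-mstd : MSTD A'
  A'-mstd = ℕP.<-≤-trans (ℕP.≤-<-trans D'-upper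
    (middle-swap X₁ X₃ Y₁ Y₃ ℓ ℓ' (ℕP.≤-<-trans D-lower (ℕP.<-≤-trans A-mstd S-upper)))) S'-lower

-- The theorem: A' is MSTD.
lemma2p3 : (n k m : ℤ) (L R M : List ℤ) →
    + 1 ≤ n →
    MSTD (L ++ R) → P n (L ++ R) →
    All (λ x → (+ 1 ≤ x) × (x ≤ n)) L →
    All (λ x → (n + + 1 ≤ x) × (x ≤ + 2 * n)) R →
    (∀ x → + 1 ≤ x → x ≤ + 4 → x ∈ L) → n ∈ L →
    n + + 1 ∈ R → (∀ x → + 2 * n - + 3 ≤ x → x ≤ + 2 * n → x ∈ R) →
    n + + 4 ≤ + 2 * k → + 0 ≤ m →
    All (λ x → (n + + 2 * k + + 3 ≤ x) × (x ≤ n + m + + 2 * k + + 2)) M →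
    (t : ℕ) (xs : Fin (suc t) → ℤ) →
    (∀ j → (xs j ∈ M) × (xs j + + 1 ∈ M)) →
    (∀ (j : Fin t) → (xs (inject₁ j) < xs (fsuc j)) × (xs (fsuc j) - xs (inject₁ j) ≤ + 2 * k - + 1)) →
    (n + + 2 * k + + 3 ≤ xs zero) → (xs zero + + 1 ≤ n + + 4 * k + + 1) →
    (n + m + + 4 ≤ xs (fromℕ t)) → (xs (fromℕ t) + + 1 ≤ n + m + + 2 * k + + 2) →
    MSTD (L ++ O₁ n k ++ M ++ O₂ n k m ++ shift R (m + + 4 * k + + 4))
lemma2p3 n k m L R M n≥1 A-mstd A-Pn L-range R-range L-start n∈L n+1∈R R-end k-large m≥0 M-range
         t xs xs-pairs xs-steps _ x₀-high xₜ-low _ =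
  Construction.A'-mstd n k m L R M n≥1 A-mstd A-Pn L-range R-range L-start n∈L n+1∈R R-end k-large m≥0
    M-range t xs xs-pairs (λ j → proj₂ (xs-steps j)) x₀-high xₜ-low
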